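{- Let $\mathbb{F}_4=\{0,1,\alpha,\alpha^2\}$ with $\alpha^2=\alpha+1$, $V=\mathbb{F}_4^{\,5}$, and let $L$ be the line spanned by $(0,1,1,1,1)$ and $(1,0,1,\alpha,\alpha^2)$; for $j=1,\dots,5$ let $P_j=L\cap C_j$. Let $H_1,\dots,H_5$ be the hyperplanes $H_1: x_2+x_3+x_4+x_5=0$, $H_2: x_1+x_3+\alpha^2x_4+\alpha x_5=0$, $H_3: x_1+x_2+\alpha x_4+\alpha^2x_5=0$, $H_4: x_1+\alpha^2x_2+\alpha x_3+x_5=0$, $H_5: x_1+\alpha x_2+\alpha^2x_3+x_4=0$, and let $Q_1=\langle 0,1,1,\alpha,\alpha\rangle$, $Q_2=\langle 0,1,\alpha,1,\alpha\rangle$, $Q_3=\langle 0,1,\alpha,\alpha,1\rangle$, $Q_4=\langle 0,1,1,\alpha^2,\alpha^2\rangle$, $Q_5=\langle 0,1,\alpha^2,1,\alpha^2\rangle$, $Q_6=\langle 0,1,\alpha^2,\alpha^2,1\rangle$. Then for every $i\in\{1,\dots,6\}$ there is a unique simplex line $L_i$ passing through $Q_i$ and intersecting every $H_j\cap C_j$ ($j=1,\dots,5$) in a point distinct from $P_j$.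
   Context: $C_j=\{x\in V:x_j=0\}$. $\langle a_1,\dots,a_5\rangle$ denotes the span of a non-zero vector. A vector of $V$ is a simplex vector if precisely one of its coordinates is zero. A point is a $1$-dimensional subspace; a simplex line is a $2$-dimensional subspace all of whose non-zero vectors are simplex vectors ($L$ is such a line). -}

module Defs where

open import Data.Fin using (Fin; zero; suc)
open import Data.Vec using (Vec; []; _∷_; lookup; zipWith; replicate; map; foldr)
open import Data.Product using (Σ; ∃; _×_; _,_)
open import Relation.Binary.PropositionalEquality using (_≡_)
open import Relation.Nullary using (¬_)

data F4 : Set where
  𝟎 𝟏 α α² : F4

infixl 6 _+F_
infixl 7 _*F_

_+F_ : F4 → F4 → F4
𝟎  +F y  = y
x  +F 𝟎  = x
𝟏  +F 𝟏  = 𝟎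
𝟏  +F α  = α²
𝟏  +F α² = α
α  +F 𝟏  = α²
α  +F α  = 𝟎
α  +F α² = 𝟏
α² +F 𝟏  = α
α² +F α  = 𝟏
α² +F α² = 𝟎

_*F_ : F4 → F4 → F4
𝟎  *F y  = 𝟎
x  *F 𝟎  = 𝟎
𝟏  *F y  = y
x  *F 𝟏  = x
α  *F α  = α²
α  *F α² = 𝟏
α² *F α  = 𝟏
α² *F α² = α

-- V = F4^5; coordinates x_1..x_5 are indexed by Fin 5 as 0..4.
V : Set
V = Vec F4 5

0V : V
0V = replicate 5 𝟎

_+V_ : V → V → V
_+V_ = zipWith _+F_

_·V_ : F4 → V → V
a ·V x = map (a *F_) x

dot : V → V → F4
dot x y = foldr (λ _ → F4) _+F_ 𝟎 (zipWith _*F_ x y)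

C : Fin 5 → V → Set
C j x = lookup x j ≡ 𝟎

SimplexVector : V → Set
SimplexVector x = Σ (Fin 5) λ j → (lookup x j ≡ 𝟎) × (∀ k → lookup x k ≡ 𝟎 → k ≡ j)

-- a 2-dimensional subspace, presented by a basis (two linearly independent vectors)
record Line : Set where
  constructor line
  field
    u v   : V
    indep : ∀ a b → (a ·V u) +V (b ·V v) ≡ 0V → (a ≡ 𝟎) × (b ≡ 𝟎)

_∈L_ : V → Line → Set
x ∈L l = Σ F4 λ a → Σ F4 λ b → x ≡ (a ·V Line.u l) +V (b ·V Line.v l)

SameLine : Line → Line → Set
SameLine l l' = ∀ x → (x ∈L l → x ∈L l') × (x ∈L l' → x ∈L l)

SimplexLine : Line → Set
SimplexLine l = ∀ x → x ∈L l → ¬ (x ≡ 0V) → SimplexVector x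

_∈pt_ : V → V → Set
x ∈pt q = Σ F4 λ a → x ≡ a ·V q

L₀ : Line
L₀ = line (𝟎 ∷ 𝟏 ∷ 𝟏 ∷ 𝟏 ∷ 𝟏 ∷ []) (𝟏 ∷ 𝟎 ∷ 𝟏 ∷ α ∷ α² ∷ []) ind
  where
  ind : ∀ a b → (a ·V (𝟎 ∷ 𝟏 ∷ 𝟏 ∷ 𝟏 ∷ 𝟏 ∷ [])) +V (b ·V (𝟏 ∷ 𝟎 ∷ 𝟏 ∷ α ∷ α² ∷ [])) ≡ 0V
        → (a ≡ 𝟎) × (b ≡ 𝟎)
  ind 𝟎 𝟎 _ = _≡_.refl , _≡_.refl
  ind 𝟎 𝟏 ()
  ind 𝟎 α ()
  ind 𝟎 α² ()
  ind 𝟏 𝟎 ()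
  ind 𝟏 𝟏 ()
  ind 𝟏 α ()
  ind 𝟏 α² ()
  ind α 𝟎 ()
  ind α 𝟏 ()
  ind α α ()
  ind α α² ()
  ind α² 𝟎 ()
  ind α² 𝟏 ()
  ind α² α ()
  ind α² α² ()

P : Fin 5 → V → Set
P j x = (x ∈L L₀) × C j x

hCoeff : Fin 5 → V
hCoeff zero                         = 𝟎 ∷ 𝟏 ∷ 𝟏 ∷ 𝟏 ∷ 𝟏 ∷ []
hCoeff (suc zero)                   = 𝟏 ∷ 𝟎 ∷ 𝟏 ∷ α² ∷ α ∷ []
hCoeff (suc (suc zero))             = 𝟏 ∷ 𝟏 ∷ 𝟎 ∷ α ∷ α² ∷ []
hCoeff (suc (suc (suc zero)))       = 𝟏 ∷ α² ∷ α ∷ 𝟎 ∷ 𝟏 ∷ []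
hCoeff (suc (suc (suc (suc zero)))) = 𝟏 ∷ α ∷ α² ∷ 𝟏 ∷ 𝟎 ∷ []

H : Fin 5 → V → Set
H j x = dot (hCoeff j) x ≡ 𝟎

Q : Fin 6 → V
Q zero                               = 𝟎 ∷ 𝟏 ∷ 𝟏 ∷ α ∷ α ∷ []
Q (suc zero)                         = 𝟎 ∷ 𝟏 ∷ α ∷ 𝟏 ∷ α ∷ []
Q (suc (suc zero))                   = 𝟎 ∷ 𝟏 ∷ α ∷ α ∷ 𝟏 ∷ []
Q (suc (suc (suc zero)))             = 𝟎 ∷ 𝟏 ∷ 𝟏 ∷ α² ∷ α² ∷ []
Q (suc (suc (suc (suc zero))))       = 𝟎 ∷ 𝟏 ∷ α² ∷ 𝟏 ∷ α² ∷ []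
Q (suc (suc (suc (suc (suc zero))))) = 𝟎 ∷ 𝟏 ∷ α² ∷ α² ∷ 𝟏 ∷ []

MeetsAwayFromP : Line → Fin 5 → Set
MeetsAwayFromP l j =
  Σ V λ p → ¬ (p ≡ 0V)
    × (∀ y → ((y ∈L l) × H j y × C j y → y ∈pt p) × (y ∈pt p → (y ∈L l) × H j y × C j y))
    × ¬ (P j p)

Good : Fin 6 → Line → Set
Good i l = SimplexLine l × (Q i ∈L l) × (∀ j → MeetsAwayFromP l j)

-- Everything is finite over F₄, so every concrete claim is settled by evaluating a decision
-- procedure; the one real argument is the uniqueness reduction. Take Lᵢ = ⟨Qᵢ, Rᵢ⟩. A good line
-- l contains Qᵢ and a nonzero point p of H₂ ∩ C₂, and among the few such p one checks that
-- either ⟨Qᵢ, p⟩ contains a nonzero non-simplex vector, or Rᵢ ∈ ⟨Qᵢ, p⟩ (whence l = Lᵢ), or Qᵢ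
-- and p are independent, so l = ⟨Qᵢ, p⟩, and ⟨Qᵢ, p⟩ meets some Hⱼ ∩ Cⱼ only in 0.
module Submission where

open import Defs
open import Data.Fin using (Fin; zero; suc)
import Data.Fin.Properties as Fin
open import Data.Nat using (ℕ)
open import Data.Product using (Σ; _×_; _,_; proj₁; proj₂)
open import Data.Sum using (_⊎_; inj₁; inj₂)
open import Data.Empty using (⊥-elim)
open import Data.Vec using (Vec; []; _∷_; lookup; zipWith; replicate; map)
open import Data.Vec.Properties using (≡-dec; map-id; map-cong)
open import Relation.Binary.PropositionalEquality using (_≡_; refl; sym; trans; cong₂; module ≡-Reasoning)
open import Relation.Nullary using (¬_; Dec; yes; no)
open import Relation.Nullary.Decidable using (map′; from-yes; _×-dec_; _⊎-dec_; _→-dec_; ¬?)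

infix 4 _≟_ _≟V_ _∈⟨_,_⟩ _∈⟨_,_⟩?

_≟_ : (x y : F4) → Dec (x ≡ y)
𝟎 ≟ 𝟎 = yes refl
𝟏 ≟ 𝟏 = yes refl
α ≟ α = yes refl
α² ≟ α² = yes refl
𝟎 ≟ 𝟏 = no λ ()
𝟎 ≟ α = no λ ()
𝟎 ≟ α² = no λ ()
𝟏 ≟ 𝟎 = no λ ()
𝟏 ≟ α = no λ ()
𝟏 ≟ α² = no λ ()
α ≟ 𝟎 = no λ ()
α ≟ 𝟏 = no λ ()
α ≟ α² = no λ ()
α² ≟ 𝟎 = no λ ()
α² ≟ 𝟏 = no λ ()
α² ≟ α = no λ ()

_≟V_ : ∀ {n} (x y : Vec F4 n) → Dec (x ≡ y)
_≟V_ = ≡-dec _≟_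

all? : {P : F4 → Set} → (∀ x → Dec (P x)) → Dec (∀ x → P x)
all? {P} P? = map′ all all⁻¹ (P? 𝟎 ×-dec P? 𝟏 ×-dec P? α ×-dec P? α²)
  where
  all : P 𝟎 × P 𝟏 × P α × P α² → ∀ x → P x
  all (p , _ , _ , _) 𝟎 = p
  all (_ , p , _ , _) 𝟏 = p
  all (_ , _ , p , _) α = p
  all (_ , _ , _ , p) α² = p
  all⁻¹ : (∀ x → P x) → P 𝟎 × P 𝟏 × P α × P α²
  all⁻¹ p = p 𝟎 , p 𝟏 , p α , p α²

any? : {P : F4 → Set} → (∀ x → Dec (P x)) → Dec (Σ F4 P)
any? {P} P? = map′ any any⁻¹ (P? 𝟎 ⊎-dec P? 𝟏 ⊎-dec P? α ⊎-dec P? α²)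
  where
  any : P 𝟎 ⊎ P 𝟏 ⊎ P α ⊎ P α² → Σ F4 P
  any (inj₁ p) = 𝟎 , p
  any (inj₂ (inj₁ p)) = 𝟏 , p
  any (inj₂ (inj₂ (inj₁ p))) = α , p
  any (inj₂ (inj₂ (inj₂ p))) = α² , p
  any⁻¹ : Σ F4 P → P 𝟎 ⊎ P 𝟏 ⊎ P α ⊎ P α²
  any⁻¹ (𝟎 , p) = inj₁ p
  any⁻¹ (𝟏 , p) = inj₂ (inj₁ p)
  any⁻¹ (α , p) = inj₂ (inj₂ (inj₁ p))
  any⁻¹ (α² , p) = inj₂ (inj₂ (inj₂ p))

all-Vec? : ∀ n {P : Vec F4 n → Set} → (∀ x → Dec (P x)) → Dec (∀ x → P x)
all-Vec? ℕ.zero P? = map′ (λ { p [] → p }) (λ p → p []) (P? [])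
all-Vec? (ℕ.suc n) P? =
  map′ (λ { p (a ∷ x) → p a x }) (λ p a x → p (a ∷ x)) (all? λ a → all-Vec? n λ x → P? (a ∷ x))

*-identityˡ : ∀ x → 𝟏 *F x ≡ x
*-identityˡ 𝟎 = refl
*-identityˡ 𝟏 = refl
*-identityˡ α = refl
*-identityˡ α² = refl

-- Proofs obtained by evaluating a decision procedure are kept opaque: unfolding them at use
-- sites makes type checking explode.
opaque
  *-assoc : ∀ x y z → (x *F y) *F z ≡ x *F (y *F z)
  *-assoc = from-yes (all? λ x → all? λ y → all? λ z → (x *F y) *F z ≟ x *F (y *F z))

  *-distribˡ-+ : ∀ x y z → x *F (y +F z) ≡ x *F y +F x *F z
  *-distribˡ-+ = from-yes (all? λ x → all? λ y → all? λ z → x *F (y +F z) ≟ x *F y +F x *F z)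

  *-distribʳ-+ : ∀ x y z → (y +F z) *F x ≡ y *F x +F z *F x
  *-distribʳ-+ = from-yes (all? λ x → all? λ y → all? λ z → (y +F z) *F x ≟ y *F x +F z *F x)

  +-interchange : ∀ w x y z → (w +F x) +F (y +F z) ≡ (w +F y) +F (x +F z)
  +-interchange = from-yes (all? λ w → all? λ x → all? λ y → all? λ z →
    (w +F x) +F (y +F z) ≟ (w +F y) +F (x +F z))

Dependent₂ : F4 → F4 → F4 → F4 → Set
Dependent₂ a₁ b₁ a₂ b₂ = Σ F4 λ c → Σ F4 λ d →
  ¬ (c ≡ 𝟎 × d ≡ 𝟎) × c *F a₁ +F d *F a₂ ≡ 𝟎 × c *F b₁ +F d *F b₂ ≡ 𝟎

Spanning₂ : F4 → F4 → F4 → F4 → Set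
Spanning₂ a₁ b₁ a₂ b₂ = ∀ a b → Σ F4 λ c → Σ F4 λ d →
  a ≡ c *F a₁ +F d *F a₂ × b ≡ c *F b₁ +F d *F b₂

opaque
  dependent⊎spanning : ∀ a₁ b₁ a₂ b₂ → Dependent₂ a₁ b₁ a₂ b₂ ⊎ Spanning₂ a₁ b₁ a₂ b₂
  dependent⊎spanning = from-yes (all? λ a₁ → all? λ b₁ → all? λ a₂ → all? λ b₂ →
    (any? λ c → any? λ d →
       ¬? ((c ≟ 𝟎) ×-dec (d ≟ 𝟎)) ×-dec (c *F a₁ +F d *F a₂ ≟ 𝟎) ×-dec (c *F b₁ +F d *F b₂ ≟ 𝟎))
    ⊎-dec (all? λ a → all? λ b → any? λ c → any? λ d →
       (a ≟ c *F a₁ +F d *F a₂) ×-dec (b ≟ c *F b₁ +F d *F b₂)))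

lincomb : ∀ {n} → F4 → F4 → Vec F4 n → Vec F4 n → Vec F4 n
lincomb a b u v = zipWith _+F_ (map (a *F_) u) (map (b *F_) v)

lincomb-lincomb-F4 : ∀ c d a b a′ b′ x y →
  c *F (a *F x +F b *F y) +F d *F (a′ *F x +F b′ *F y) ≡ (c *F a +F d *F a′) *F x +F (c *F b +F d *F b′) *F y
lincomb-lincomb-F4 c d a b a′ b′ x y = begin
  c *F (a *F x +F b *F y) +F d *F (a′ *F x +F b′ *F y)
    ≡⟨ cong₂ _+F_ (*-distribˡ-+ c (a *F x) (b *F y)) (*-distribˡ-+ d (a′ *F x) (b′ *F y)) ⟩
  (c *F (a *F x) +F c *F (b *F y)) +F (d *F (a′ *F x) +F d *F (b′ *F y))
    ≡⟨ +-interchange (c *F (a *F x)) (c *F (b *F y)) (d *F (a′ *F x)) (d *F (b′ *F y)) ⟩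
  (c *F (a *F x) +F d *F (a′ *F x)) +F (c *F (b *F y) +F d *F (b′ *F y))
    ≡⟨ sym (cong₂ _+F_ (cong₂ _+F_ (*-assoc c a x) (*-assoc d a′ x))
                       (cong₂ _+F_ (*-assoc c b y) (*-assoc d b′ y))) ⟩
  ((c *F a) *F x +F (d *F a′) *F x) +F ((c *F b) *F y +F (d *F b′) *F y)
    ≡⟨ sym (cong₂ _+F_ (*-distribʳ-+ x (c *F a) (d *F a′)) (*-distribʳ-+ y (c *F b) (d *F b′))) ⟩
  (c *F a +F d *F a′) *F x +F (c *F b +F d *F b′) *F y ∎
  where open ≡-Reasoning

lincomb-lincomb : ∀ {n} c d a b a′ b′ (u v : Vec F4 n) →
  lincomb c d (lincomb a b u v) (lincomb a′ b′ u v) ≡ lincomb (c *F a +F d *F a′) (c *F b +F d *F b′) u v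
lincomb-lincomb c d a b a′ b′ [] [] = refl
lincomb-lincomb c d a b a′ b′ (x ∷ u) (y ∷ v) =
  cong₂ _∷_ (lincomb-lincomb-F4 c d a b a′ b′ x y) (lincomb-lincomb c d a b a′ b′ u v)

lincomb-𝟎 : ∀ {n} (u v : Vec F4 n) → lincomb 𝟎 𝟎 u v ≡ replicate n 𝟎
lincomb-𝟎 [] [] = refl
lincomb-𝟎 (_ ∷ u) (_ ∷ v) = cong₂ _∷_ refl (lincomb-𝟎 u v)

_∈⟨_,_⟩ : V → V → V → Set
x ∈⟨ u , v ⟩ = Σ F4 λ a → Σ F4 λ b → x ≡ (a ·V u) +V (b ·V v)

Independent : V → V → Set
Independent u v = ∀ a b → (a ·V u) +V (b ·V v) ≡ 0V → (a ≡ 𝟎) × (b ≡ 𝟎)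

SimplexSpan : V → V → Set
SimplexSpan u v = ∀ x → x ∈⟨ u , v ⟩ → ¬ (x ≡ 0V) → SimplexVector x

lincomb-∈⟨⟩ : ∀ {u v x y} → x ∈⟨ u , v ⟩ → y ∈⟨ u , v ⟩ → ∀ c d → (c ·V x) +V (d ·V y) ∈⟨ u , v ⟩
lincomb-∈⟨⟩ {u} {v} (a , b , refl) (a′ , b′ , refl) c d =
  c *F a +F d *F a′ , c *F b +F d *F b′ , lincomb-lincomb c d a b a′ b′ u v

⟨⟩⊆⟨⟩ : ∀ {u v q p x} → q ∈⟨ u , v ⟩ → p ∈⟨ u , v ⟩ → x ∈⟨ q , p ⟩ → x ∈⟨ u , v ⟩
⟨⟩⊆⟨⟩ q∈ p∈ (c , d , refl) = lincomb-∈⟨⟩ q∈ p∈ c d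

⟨⟩⊇⟨⟩ : ∀ {u v q p x} → q ∈⟨ u , v ⟩ → p ∈⟨ u , v ⟩ → Independent q p → x ∈⟨ u , v ⟩ → x ∈⟨ q , p ⟩
⟨⟩⊇⟨⟩ {u} {v} (a₁ , b₁ , refl) (a₂ , b₂ , refl) ind (a , b , refl)
  with dependent⊎spanning a₁ b₁ a₂ b₂
... | inj₁ (c , d , c,d≢𝟎 , ea , eb) = ⊥-elim (c,d≢𝟎 (ind c d (begin
  lincomb c d (lincomb a₁ b₁ u v) (lincomb a₂ b₂ u v)
    ≡⟨ lincomb-lincomb c d a₁ b₁ a₂ b₂ u v ⟩
  lincomb (c *F a₁ +F d *F a₂) (c *F b₁ +F d *F b₂) u v
    ≡⟨ cong₂ (λ s t → lincomb s t u v) ea eb ⟩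
  lincomb 𝟎 𝟎 u v
    ≡⟨ lincomb-𝟎 u v ⟩
  0V ∎)))
  where open ≡-Reasoning
... | inj₂ spanning with spanning a b
... | c , d , ea , eb = c , d , (begin
  lincomb a b u v
    ≡⟨ cong₂ (λ s t → lincomb s t u v) ea eb ⟩
  lincomb (c *F a₁ +F d *F a₂) (c *F b₁ +F d *F b₂) u v
    ≡⟨ sym (lincomb-lincomb c d a₁ b₁ a₂ b₂ u v) ⟩
  lincomb c d (lincomb a₁ b₁ u v) (lincomb a₂ b₂ u v) ∎)
  where open ≡-Reasoning

sameLine-basis : ∀ l {q p} (ind : Independent q p) → q ∈L l → p ∈L l → SameLine l (line q p ind)
sameLine-basis l ind q∈ p∈ x = ⟨⟩⊇⟨⟩ q∈ p∈ ind , ⟨⟩⊆⟨⟩ q∈ p∈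

∈pt-refl : ∀ x → x ∈pt x
∈pt-refl x = 𝟏 , sym (trans (map-cong *-identityˡ x) (map-id x))

all-∈⟨⟩? : ∀ u v {P : V → Set} → (∀ x → Dec (P x)) → Dec (∀ x → x ∈⟨ u , v ⟩ → P x)
all-∈⟨⟩? u v P? = map′ (λ { p x (a , b , refl) → p a b }) (λ p a b → p _ (a , b , refl))
  (all? λ a → all? λ b → P? ((a ·V u) +V (b ·V v)))

any-∈⟨⟩? : ∀ u v {P : V → Set} → (∀ x → Dec (P x)) → Dec (Σ V λ x → x ∈⟨ u , v ⟩ × P x)
any-∈⟨⟩? u v P? =
  map′ (λ { (a , b , p) → _ , (a , b , refl) , p }) (λ { (_ , (a , b , refl) , p) → a , b , p })
  (any? λ a → any? λ b → P? ((a ·V u) +V (b ·V v)))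

all-∈pt? : ∀ p {P : V → Set} → (∀ x → Dec (P x)) → Dec (∀ x → x ∈pt p → P x)
all-∈pt? p P? = map′ (λ { f x (c , refl) → f c }) (λ f c → f _ (c , refl)) (all? λ c → P? (c ·V p))

_∈⟨_,_⟩? : ∀ x u v → Dec (x ∈⟨ u , v ⟩)
x ∈⟨ u , v ⟩? = any? λ a → any? λ b → x ≟V (a ·V u) +V (b ·V v)

_∈pt?_ : ∀ x p → Dec (x ∈pt p)
x ∈pt? p = any? λ a → x ≟V a ·V p

H? : ∀ j x → Dec (H j x)
H? j x = dot (hCoeff j) x ≟ 𝟎

C? : ∀ j x → Dec (C j x)
C? j x = lookup x j ≟ 𝟎

simplexVector? : ∀ x → Dec (SimplexVector x)
simplexVector? x = Fin.any? λ j → C? j x ×-dec Fin.all? λ k → C? k x →-dec k Fin.≟ j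

simplexSpan? : ∀ u v → Dec (SimplexSpan u v)
simplexSpan? u v = all-∈⟨⟩? u v λ x → ¬? (x ≟V 0V) →-dec simplexVector? x

independent? : ∀ u v → Dec (Independent u v)
independent? u v = all? λ a → all? λ b → (a ·V u) +V (b ·V v) ≟V 0V →-dec (a ≟ 𝟎) ×-dec (b ≟ 𝟎)

MeetsAwayFromPAt : Line → Fin 5 → V → Set
MeetsAwayFromPAt l j p = ¬ (p ≡ 0V)
  × (∀ y → ((y ∈L l) × H j y × C j y → y ∈pt p) × (y ∈pt p → (y ∈L l) × H j y × C j y))
  × ¬ (P j p)

meetsAwayFromPAt? : ∀ l j p → Dec (MeetsAwayFromPAt l j p)
meetsAwayFromPAt? l@(line u v _) j p =
  ¬? (p ≟V 0V) ×-dec ⇔? ×-dec ¬? (p ∈⟨ Line.u L₀ , Line.v L₀ ⟩? ×-dec C? j p)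
  where
  ⇔? : Dec (∀ y → ((y ∈L l) × H j y × C j y → y ∈pt p) × (y ∈pt p → (y ∈L l) × H j y × C j y))
  ⇔? = map′ (λ { (⊆ , ⊇) y → (λ { (y∈ , Hy , Cy) → ⊆ y y∈ (Hy , Cy) }) , ⊇ y })
            (λ ⇔ → (λ y y∈ HCy → proj₁ (⇔ y) (y∈ , HCy)) , (λ y → proj₂ (⇔ y)))
            (all-∈⟨⟩? u v (λ y → (H? j y ×-dec C? j y) →-dec y ∈pt? p)
             ×-dec all-∈pt? p (λ y → y ∈⟨ u , v ⟩? ×-dec H? j y ×-dec C? j y))

meeting-point : ∀ l j {p} → MeetsAwayFromPAt l j p → ¬ (p ≡ 0V) × (p ∈L l) × H j p × C j p
meeting-point l j {p} (p≢0 , ⇔ , _) = p≢0 , proj₂ (⇔ p) (∈pt-refl p)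

meetsAwayFromP? : ∀ l j → Dec (MeetsAwayFromP l j)
meetsAwayFromP? l@(line u v _) j =
  map′ (λ (p , _ , m) → p , m) (λ (p , m) → p , proj₁ (proj₂ (meeting-point l j m)) , m)
       (any-∈⟨⟩? u v (meetsAwayFromPAt? l j))

good? : ∀ i l → Dec (Good i l)
good? i l@(line u v _) = simplexSpan? u v ×-dec Q i ∈⟨ u , v ⟩? ×-dec Fin.all? (meetsAwayFromP? l)

-- Rᵢ spans the point where Lᵢ meets H₂ ∩ C₂
R : Fin 6 → V
R zero                               = 𝟏 ∷ 𝟎 ∷ α ∷ α ∷ 𝟏 ∷ []
R (suc zero)                         = 𝟏 ∷ 𝟎 ∷ α ∷ α² ∷ α² ∷ []
R (suc (suc zero))                   = 𝟏 ∷ 𝟎 ∷ 𝟏 ∷ α² ∷ 𝟏 ∷ []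
R (suc (suc (suc zero)))             = 𝟏 ∷ 𝟎 ∷ α² ∷ 𝟏 ∷ α² ∷ []
R (suc (suc (suc (suc zero))))       = 𝟏 ∷ 𝟎 ∷ 𝟏 ∷ 𝟏 ∷ α ∷ []
R (suc (suc (suc (suc (suc zero))))) = 𝟏 ∷ 𝟎 ∷ α² ∷ α ∷ α ∷ []

opaque
  Q-R-independent : ∀ i → Independent (Q i) (R i)
  Q-R-independent = from-yes (Fin.all? λ i → independent? (Q i) (R i))

Lᵢ : Fin 6 → Line
Lᵢ i = line (Q i) (R i) (Q-R-independent i)

opaque
  Lᵢ-good : ∀ i → Good i (Lᵢ i)
  Lᵢ-good = from-yes (Fin.all? λ i → good? i (Lᵢ i))

MissesSomeH∩C : V → V → Set
MissesSomeH∩C q p = Σ (Fin 5) λ j → ∀ x → x ∈⟨ q , p ⟩ → H j x → C j x → x ≡ 0V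

-- index suc zero is the paper's H₂, C₂
opaque
  classify : ∀ i p → H (suc zero) p → C (suc zero) p → ¬ (p ≡ 0V) →
    ¬ SimplexSpan (Q i) p ⊎ R i ∈⟨ Q i , p ⟩ ⊎ (Independent (Q i) p × MissesSomeH∩C (Q i) p)
  classify = from-yes (Fin.all? λ i → all-Vec? 5 λ p →
    H? (suc zero) p →-dec C? (suc zero) p →-dec ¬? (p ≟V 0V) →-dec
      (¬? (simplexSpan? (Q i) p) ⊎-dec R i ∈⟨ Q i , p ⟩? ⊎-dec
       (independent? (Q i) p ×-dec Fin.any? λ j →
          all-∈⟨⟩? (Q i) p λ x → H? j x →-dec C? j x →-dec x ≟V 0V)))

Lᵢ-unique : ∀ i l → Good i l → SameLine l (Lᵢ i)
Lᵢ-unique i l (simplex , Q∈ , meets) with meeting-point l (suc zero) (proj₂ (meets (suc zero)))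
... | p≢0 , p∈ , Hp , Cp with classify i _ Hp Cp p≢0
... | inj₁ ¬simplex = ⊥-elim (¬simplex λ x x∈ → simplex x (⟨⟩⊆⟨⟩ Q∈ p∈ x∈))
... | inj₂ (inj₁ R∈) = sameLine-basis l (Q-R-independent i) Q∈ (⟨⟩⊆⟨⟩ Q∈ p∈ R∈)
... | inj₂ (inj₂ (ind , j , misses)) with meeting-point l j (proj₂ (meets j))
... | w≢0 , w∈ , Hw , Cw = ⊥-elim (w≢0 (misses _ (⟨⟩⊇⟨⟩ Q∈ p∈ ind w∈) Hw Cw))

lemma3 : (i : Fin 6) → Σ Line λ l → Good i l × (∀ l' → Good i l' → SameLine l' l)
lemma3 i = Lᵢ i , Lᵢ-good i , Lᵢ-unique i
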